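{- There is a polynomial function $P$ such that for every positive integer $n$, the set $Q_n$ has an SOS refutation of degree at most $2$ and of monomial-size at most $P(n)$.
   Context: For a positive integer $n$, consider Boolean variables $x_{ij}$ with twin variables $\bar{x}_{ij}$ for $i\in[n]$, $j\in[2n]$. Let $\mathrm{ks}_i=\sum_{j\in[2n]}x_{ij}-n$. The set $Q_n$ consists of the equality constraints $\mathrm{ks}_1-1/2=0$; $\mathrm{ks}_i^2-\mathrm{ks}_{i+1}=0$ for each $i\in[n-1]$; and $\mathrm{ks}_n^2=0$. An SOS refutation of a set $Q$ of constraints $q=0$ is a polynomial identity $-1=\sum_{i}r_i^2+\sum_{q\in Q}t_q q+\sum_{i,j}\big(u_{ij}(x_{ij}^2-x_{ij})+v_{ij}(x_{ij}+\bar{x}_{ij}-1)\big)$ with real polynomials $r_i,t_q,u_{ij},v_{ij}$. Its degree is at most $d$ if each of $r_i^2$, $t_q q$, $u_{ij}(x_{ij}^2-x_{ij})$, $v_{ij}(x_{ij}+\bar{x}_{ij}-1)$ has degree at most $d$. Its explicit monomials are all monomials appearing in the polynomials $r_i$, $t_q$, $q$, $u_{ij}$, $v_{ij}$, $x_{ij}^2-x_{ij}$, $x_{ij}+\bar{x}_{ij}-1$, and its monomial-size is the number of explicit monomials counted with multiplicity. -}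

module Defs where

open import Data.Bool using (Bool; true; false)
open import Data.Nat using (ℕ; zero; suc; _+_; _*_; _≤_; _⊔_)
open import Data.Nat.Properties using () renaming (_≟_ to _≟ℕ_)
open import Data.Integer using (+_)
open import Data.Rational using (ℚ; 0ℚ; 1ℚ; ½; _/_) renaming (_+_ to _+ℚ_; _*_ to _*ℚ_; -_ to -ℚ_)
open import Data.Rational.Properties using () renaming (_≟_ to _≟ℚ_)
open import Data.Fin using (Fin; zero; suc; inject₁; fromℕ)
open import Data.Fin.Properties using (all?)
open import Data.List using (List; []; _∷_; _++_; map; concat; length; filter; deduplicate; lookup; allFin; foldr)
open import Data.Product using (_×_; _,_; proj₁; proj₂)
open import Relation.Binary.PropositionalEquality using (_≡_)
open import Relation.Nullary using (Dec; yes; no; ¬_; ¬?)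
open import Relation.Nullary.Decidable using (_×-dec_)

-- Formal polynomials over ℚ in the variables x_{ij}, x̄_{ij}
-- (i ∈ Fin n, j ∈ Fin (2n)); the Bool selects the twin:
-- false ↦ x_{ij}, true ↦ x̄_{ij}.

Mono : ℕ → Set
Mono n = Fin n → Fin (2 * n) → Bool → ℕ

_≈ᵐ_ : ∀ {n} → Mono n → Mono n → Set
m ≈ᵐ m' = ∀ i j b → m i j b ≡ m' i j b

_≈ᵐ?_ : ∀ {n} (m m' : Mono n) → Dec (m ≈ᵐ m')
m ≈ᵐ? m' = all? λ i → all? λ j → bool? i j
  where
  bool? : ∀ i j → Dec (∀ b → m i j b ≡ m' i j b)
  bool? i j with m i j false ≟ℕ m' i j false | m i j true ≟ℕ m' i j true
  ... | yes p | yes q = yes λ { false → p ; true → q }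
  ... | no ¬p | _     = no λ f → ¬p (f false)
  ... | yes _ | no ¬q = no λ f → ¬q (f true)

monoOne : ∀ {n} → Mono n
monoOne _ _ _ = 0

monoMul : ∀ {n} → Mono n → Mono n → Mono n
monoMul m m' i j b = m i j b + m' i j b

monoVar : ∀ {n} → Fin n → Fin (2 * n) → Bool → Mono n
monoVar {n} i j b i' j' b' with Data.Fin._≟_ i i' | Data.Fin._≟_ j j' | b Data.Bool.≟ b'
... | yes _ | yes _ | yes _ = 1
... | _     | _     | _     = 0

finSum : ∀ {k} → (Fin k → ℕ) → ℕ
finSum {zero}  f = 0
finSum {suc k} f = f zero + finSum (λ i → f (suc i))

monoDeg : ∀ {n} → Mono n → ℕ
monoDeg m = finSum λ i → finSum λ j → m i j false + m i j true

-- A polynomial is represented by a finite list of terms (coefficient, monomial);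
-- repeated monomials are allowed, their coefficients add up.
Poly : ℕ → Set
Poly n = List (ℚ × Mono n)

coeff : ∀ {n} → Poly n → Mono n → ℚ
coeff []            m = 0ℚ
coeff ((c , m') ∷ p) m with m' ≈ᵐ? m
... | yes _ = c +ℚ coeff p m
... | no  _ = coeff p m

_≈ₚ_ : ∀ {n} → Poly n → Poly n → Set
p ≈ₚ q = ∀ m → coeff p m ≡ coeff q m

DegLe : ∀ {n} → Poly n → ℕ → Set
DegLe p d = ∀ m → ¬ (coeff p m ≡ 0ℚ) → monoDeg m ≤ d

monomials : ∀ {n} → Poly n → List (Mono n)
monomials p = deduplicate _≈ᵐ?_ (filter (λ m → ¬? (coeff p m ≟ℚ 0ℚ)) (map proj₂ p))

nMonos : ∀ {n} → Poly n → ℕ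
nMonos p = length (monomials p)

const : ∀ {n} → ℚ → Poly n
const c = (c , monoOne) ∷ []

var : ∀ {n} → Fin n → Fin (2 * n) → Bool → Poly n
var i j b = (1ℚ , monoVar i j b) ∷ []

_⊕_ : ∀ {n} → Poly n → Poly n → Poly n
p ⊕ q = p ++ q

_⊗_ : ∀ {n} → Poly n → Poly n → Poly n
p ⊗ q = concat (map (λ { (c , m) → map (λ { (c' , m') → (c *ℚ c' , monoMul m m') }) q }) p)

neg : ∀ {n} → Poly n → Poly n
neg p = map (λ { (c , m) → (-ℚ c , m) }) p

_⊖_ : ∀ {n} → Poly n → Poly n → Poly n
p ⊖ q = p ⊕ neg q

sumL : ∀ {n} → List (Poly n) → Poly n
sumL = foldr _⊕_ []

sumF : ∀ {n k} → (Fin k → Poly n) → Poly n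
sumF f = sumL (map f (allFin _))

sumℕ : List ℕ → ℕ
sumℕ = foldr _+_ 0

x : ∀ {n} → Fin n → Fin (2 * n) → Poly n
x i j = var i j false

x̄ : ∀ {n} → Fin n → Fin (2 * n) → Poly n
x̄ i j = var i j true

ℕtoℚ : ℕ → ℚ
ℕtoℚ k = (+ k) / 1

ks : ∀ {n} → Fin n → Poly n
ks {n} i = sumF (λ j → x i j) ⊖ const (ℕtoℚ n)

Q : (n : ℕ) → List (Poly n)
Q zero    = []
Q (suc m) =
  (ks zero ⊖ const ½)
  ∷ (map (λ i → (ks (inject₁ i) ⊗ ks (inject₁ i)) ⊖ ks (suc i)) (allFin m)
     ++ ((ks (fromℕ m) ⊗ ks (fromℕ m)) ∷ []))

boolAx : ∀ {n} → Fin n → Fin (2 * n) → Poly n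
boolAx i j = (x i j ⊗ x i j) ⊖ x i j

twinAx : ∀ {n} → Fin n → Fin (2 * n) → Poly n
twinAx i j = (x i j ⊕ x̄ i j) ⊖ const 1ℚ

record SOSRefutation (n : ℕ) : Set where
  field
    r : List (Poly n)
    t : Fin (length (Q n)) → Poly n
    u : Fin n → Fin (2 * n) → Poly n
    v : Fin n → Fin (2 * n) → Poly n
    identity :
      const (-ℚ 1ℚ) ≈ₚ
        (sumL (map (λ ri → ri ⊗ ri) r)
         ⊕ (sumF (λ k → t k ⊗ lookup (Q n) k)
         ⊕ sumF (λ i → sumF (λ j → (u i j ⊗ boolAx i j) ⊕ (v i j ⊗ twinAx i j)))))

open SOSRefutation public

HasDegreeAtMost : ∀ {n} → SOSRefutation n → ℕ → Set
HasDegreeAtMost {n} R d =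
  (∀ k → k Data.List.Membership.Propositional.∈ r R → DegLe (k ⊗ k) d)
  × (∀ k → DegLe (t R k ⊗ lookup (Q n) k) d)
  × (∀ i j → DegLe (u R i j ⊗ boolAx i j) d)
  × (∀ i j → DegLe (v R i j ⊗ twinAx i j) d)
  where import Data.List.Membership.Propositional

monomialSize : ∀ {n} → SOSRefutation n → ℕ
monomialSize {n} R =
  sumℕ (map nMonos (r R))
  + finSum (λ k → nMonos (t R k) + nMonos (lookup (Q n) k))
  + finSum (λ i → finSum (λ j →
      nMonos (u R i j) + nMonos (v R i j) + nMonos (boolAx i j) + nMonos (twinAx i j)))

-- Put w₁ = n + 3 and w_{i+1} = w_i².  Then
--   Σ_{i<n} (w_i ks_{i+1} − ½)² + (w₁ ks₁ + w₁/2)(ks₁ − ½) − Σ_{i<n} w_i (ks_i² − ks_{i+1}) − w_n ks_n² = −1 :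
-- since (w_i ks_{i+1} − ½)² = w_{i+1} ks_{i+1}² − w_i ks_{i+1} + ¼, the terms in ks telescope away and the
-- constants add up to (n − 1)/4 − w₁/4 = −1.  This refutation has degree 2 and consists of O(n) polynomials
-- with O(n²) monomials each.  The coefficients w_i are doubly exponential, but monomial-size ignores them.

module Submission where

open import Defs
open import Data.Nat using (ℕ; _*_; _^_; _≤_)
open import Data.Product using (Σ; _×_)

open import Algebra.Bundles using (CommutativeMonoid; CommutativeRing)
import Algebra.Properties.CommutativeSemigroup as CommSemigroupProperties
open import Data.Bool using (Bool; true; false)
import Data.Bool as Bool
open import Data.Empty using (⊥-elim)
open import Data.Fin using (Fin; zero; suc; toℕ; inject₁; fromℕ)
import Data.Fin as Fin
open import Data.Fin.Properties using (suc-injective; toℕ-inject₁; toℕ-fromℕ)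
open import Data.List using (List; []; _∷_; [_]; _++_; map; concat; tabulate; allFin; lookup; length; filter)
open import Data.List.Properties
  using (map-tabulate; map-++; concat-++; length-++; length-map; length-tabulate; length-filter; length-deduplicate)
open import Data.List.Membership.Propositional.Properties using (∈-lookup)
open import Data.List.Relation.Unary.All as All using (All; []; _∷_)
open import Data.List.Relation.Unary.All.Properties using (++⁺; map⁺; tabulate⁺)
open import Data.Nat using (zero; suc; _+_; z≤n; s≤s)
open import Data.Nat.Properties
  using (≤-trans; ≤-reflexive; +-mono-≤; +-monoˡ-≤; m≤m+n; m≤n+m; +-identityʳ; *-identityʳ; +-commutativeSemigroup)
open import Data.Nat.Tactic.RingSolver using (solve-∀)
open import Data.Product using (_,_; proj₂)
open import Data.Rational using (ℚ; 0ℚ; 1ℚ; ½)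
  renaming (_+_ to _+ℚ_; _*_ to _*ℚ_; -_ to -ℚ_; _-_ to _-ℚ_)
import Data.Rational.Properties as ℚ
open import Data.Rational.Solver using (module +-*-Solver)
open import Relation.Binary.PropositionalEquality
  using (_≡_; _≢_; refl; sym; trans; cong; cong₂; module ≡-Reasoning)
open import Relation.Nullary using (yes; no; ¬_; ¬?)

open import Algebra.Properties.Semiring.Sum (CommutativeRing.semiring ℚ.+-*-commutativeRing)
  using (sum-syntax; ∑-distrib-+; sum-cong-≗; sum-replicate; sum-replicate-zero)
open import Algebra.Properties.Semiring.Mult (CommutativeRing.semiring ℚ.+-*-commutativeRing)
  using (×-assoc-*) renaming (_×_ to _×ℚ_)
open CommSemigroupProperties +-commutativeSemigroup using () renaming (interchange to +-interchange)
open CommSemigroupProperties (CommutativeMonoid.commutativeSemigroup ℚ.+-0-commutativeMonoid)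
  using () renaming (interchange to +ℚ-interchange)
open CommSemigroupProperties (CommutativeMonoid.commutativeSemigroup ℚ.*-1-commutativeMonoid)
  using () renaming (x∙yz≈y∙xz to *ℚ-x∙yz≈y∙xz)

private variable
  n k : ℕ

finSum-cong : {f g : Fin k → ℕ} → (∀ i → f i ≡ g i) → finSum f ≡ finSum g
finSum-cong {zero}  f≗g = refl
finSum-cong {suc k} f≗g = cong₂ _+_ (f≗g zero) (finSum-cong (λ i → f≗g (suc i)))

finSum-+ : (f g : Fin k → ℕ) → finSum (λ i → f i + g i) ≡ finSum f + finSum g
finSum-+ {zero}  f g = refl
finSum-+ {suc k} f g =
  trans (cong (f zero + g zero +_) (finSum-+ (λ i → f (suc i)) (λ i → g (suc i))))
        (+-interchange (f zero) (g zero) _ _)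

finSum-zero : {f : Fin k → ℕ} → (∀ i → f i ≡ 0) → finSum f ≡ 0
finSum-zero {zero}  f≗0 = refl
finSum-zero {suc k} f≗0 = cong₂ _+_ (f≗0 zero) (finSum-zero (λ i → f≗0 (suc i)))

finSum-single : {f : Fin k → ℕ} (i : Fin k) → (∀ j → j ≢ i → f j ≡ 0) → finSum f ≡ f i
finSum-single {suc k} {f} zero    f≗0 =
  trans (cong (f zero +_) (finSum-zero (λ j → f≗0 (suc j) λ ()))) (+-identityʳ (f zero))
finSum-single {suc k} {f} (suc i) f≗0 =
  trans (cong (_+ finSum (λ j → f (suc j))) (f≗0 zero λ ()))
        (finSum-single i (λ j j≢i → f≗0 (suc j) (λ sj≡si → j≢i (suc-injective sj≡si))))

monoDeg-cong : {a a' : Mono n} → a ≈ᵐ a' → monoDeg a ≡ monoDeg a'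
monoDeg-cong {n} a≈a' =
  finSum-cong {n} λ i → finSum-cong {2 * n} λ j → cong₂ _+_ (a≈a' i j false) (a≈a' i j true)

monoDeg-monoMul : (a a' : Mono n) → monoDeg (monoMul a a') ≡ monoDeg a + monoDeg a'
monoDeg-monoMul {n} a a' =
  trans (finSum-cong {n} λ i →
           trans (finSum-cong {2 * n} λ j → +-interchange (a i j false) (a' i j false) (a i j true) (a' i j true))
                 (finSum-+ (λ j → a i j false + a i j true) (λ j → a' i j false + a' i j true)))
        (finSum-+ (λ i → finSum λ j → a i j false + a i j true) (λ i → finSum λ j → a' i j false + a' i j true))

monoDeg-monoOne : monoDeg (monoOne {n}) ≡ 0
monoDeg-monoOne {n} = finSum-zero {n} λ _ → finSum-zero {2 * n} λ _ → refl

monoVar-≢ : (i i' : Fin n) (j j' : Fin (2 * n)) (b b' : Bool) →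
            ¬ (i ≡ i' × j ≡ j' × b ≡ b') → monoVar i j b i' j' b' ≡ 0
monoVar-≢ i i' j j' b b' distinct with i Fin.≟ i' | j Fin.≟ j' | b Bool.≟ b'
... | yes i≡i' | yes j≡j' | yes b≡b' = ⊥-elim (distinct (i≡i' , j≡j' , b≡b'))
... | yes _    | yes _    | no _     = refl
... | yes _    | no _     | _        = refl
... | no _     | _        | _        = refl

monoVar-diag : (i : Fin n) (j : Fin (2 * n)) (b : Bool) → monoVar i j b i j b ≡ 1
monoVar-diag i j b with i Fin.≟ i | j Fin.≟ j | b Bool.≟ b
... | yes _ | yes _  | yes _  = refl
... | yes _ | yes _  | no b≢b = ⊥-elim (b≢b refl)
... | yes _ | no j≢j | _      = ⊥-elim (j≢j refl)
... | no i≢i | _     | _      = ⊥-elim (i≢i refl)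

monoDeg-monoVar : (i : Fin n) (j : Fin (2 * n)) (b : Bool) → monoDeg (monoVar i j b) ≡ 1
monoDeg-monoVar {n} i j b = begin
  monoDeg (monoVar i j b)
    ≡⟨ finSum-single i (λ i' i'≢i → finSum-zero {2 * n} λ j' →
         cong₂ _+_ (vanishes i' j' false λ (i≡i' , _) → i'≢i (sym i≡i'))
                   (vanishes i' j' true  λ (i≡i' , _) → i'≢i (sym i≡i'))) ⟩
  finSum (λ j' → monoVar i j b i j' false + monoVar i j b i j' true)
    ≡⟨ finSum-single j (λ j' j'≢j →
         cong₂ _+_ (vanishes i j' false λ (_ , j≡j' , _) → j'≢j (sym j≡j'))
                   (vanishes i j' true  λ (_ , j≡j' , _) → j'≢j (sym j≡j'))) ⟩
  monoVar i j b i j false + monoVar i j b i j true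
    ≡⟨ exactly-one b ⟩
  1 ∎
  where
  open ≡-Reasoning
  vanishes : ∀ i' j' b' → ¬ (i ≡ i' × j ≡ j' × b ≡ b') → monoVar i j b i' j' b' ≡ 0
  vanishes i' j' = monoVar-≢ i i' j j' b
  exactly-one : ∀ b → monoVar i j b i j false + monoVar i j b i j true ≡ 1
  exactly-one false = cong₂ _+_ (monoVar-diag i j false) (monoVar-≢ i i j j false true λ { (_ , _ , ()) })
  exactly-one true  = cong₂ _+_ (monoVar-≢ i i j j true false λ { (_ , _ , ()) }) (monoVar-diag i j true)

scale : ℚ → Poly n → Poly n
scale c = map λ (d , a) → (c *ℚ d , a)

coeff-⊕ : (p q : Poly n) (m : Mono n) → coeff (p ⊕ q) m ≡ coeff p m +ℚ coeff q m
coeff-⊕ []            q m = sym (ℚ.+-identityˡ (coeff q m))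
coeff-⊕ ((c , a) ∷ p) q m with a ≈ᵐ? m
... | yes _ = trans (cong (c +ℚ_) (coeff-⊕ p q m)) (sym (ℚ.+-assoc c (coeff p m) (coeff q m)))
... | no  _ = coeff-⊕ p q m

coeff-neg : (p : Poly n) (m : Mono n) → coeff (neg p) m ≡ -ℚ coeff p m
coeff-neg []            m = refl
coeff-neg ((c , a) ∷ p) m with a ≈ᵐ? m
... | yes _ = trans (cong (-ℚ c +ℚ_) (coeff-neg p m)) (sym (ℚ.neg-distrib-+ c (coeff p m)))
... | no  _ = coeff-neg p m

coeff-scale : (c : ℚ) (p : Poly n) (m : Mono n) → coeff (scale c p) m ≡ c *ℚ coeff p m
coeff-scale c []            m = sym (ℚ.*-zeroʳ c)
coeff-scale c ((d , a) ∷ p) m with a ≈ᵐ? m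
... | yes _ = trans (cong (c *ℚ d +ℚ_) (coeff-scale c p m)) (sym (ℚ.*-distribˡ-+ c d (coeff p m)))
... | no  _ = coeff-scale c p m

coeff-const : (c : ℚ) (m : Mono n) → coeff (const c) m ≡ c *ℚ coeff (const 1ℚ) m
coeff-const {n} c m with monoOne {n} ≈ᵐ? m
... | yes _ = trans (ℚ.+-identityʳ c) (sym (ℚ.*-identityʳ c))
... | no  _ = sym (ℚ.*-zeroʳ c)

coeff-≈ᵐ : {a a' : Mono n} → a ≈ᵐ a' → (c : ℚ) (p : Poly n) (m : Mono n) →
           coeff ((c , a) ∷ p) m ≡ coeff ((c , a') ∷ p) m
coeff-≈ᵐ {a = a} {a'} a≈a' c p m with a ≈ᵐ? m | a' ≈ᵐ? m
... | yes _   | yes _    = refl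
... | no  _   | no  _    = refl
... | yes a≈m | no  a'≉m = ⊥-elim (a'≉m λ i j b → trans (sym (a≈a' i j b)) (a≈m i j b))
... | no  a≉m | yes a'≈m = ⊥-elim (a≉m λ i j b → trans (a≈a' i j b) (a'≈m i j b))

⊗-distribʳ-⊕ : (p p' q : Poly n) → (p ⊕ p') ⊗ q ≡ (p ⊗ q) ⊕ (p' ⊗ q)
⊗-distribʳ-⊕ p p' q = trans (cong concat (map-++ _ p p')) (sym (concat-++ (map _ p) (map _ p')))

coeff-⊕-⊗ : (p p' q : Poly n) (m : Mono n) → coeff ((p ⊕ p') ⊗ q) m ≡ coeff (p ⊗ q) m +ℚ coeff (p' ⊗ q) m
coeff-⊕-⊗ p p' q m = trans (cong (λ s → coeff s m) (⊗-distribʳ-⊕ p p' q)) (coeff-⊕ (p ⊗ q) (p' ⊗ q) m)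

-- coeff (p ⊗ q) m is additive in either factor, read as a list of terms, so identities that
-- are additive on both sides reduce by additive-ext to single terms.
record Additive (Φ : Poly n → ℚ) : Set where
  constructor mkAdditive
  field
    on-[] : Φ [] ≡ 0ℚ
    on-∷  : ∀ s p → Φ (s ∷ p) ≡ Φ [ s ] +ℚ Φ p

additive-ext : {Φ Ψ : Poly n → ℚ} → Additive Φ → Additive Ψ →
               (∀ s → Φ [ s ] ≡ Ψ [ s ]) → ∀ p → Φ p ≡ Ψ p
additive-ext (mkAdditive Φ[] _) (mkAdditive Ψ[] _) agree [] = trans Φ[] (sym Ψ[])
additive-ext Φ-add@(mkAdditive _ Φ∷) Ψ-add@(mkAdditive _ Ψ∷) agree (s ∷ p) =
  trans (Φ∷ s p) (trans (cong₂ _+ℚ_ (agree s) (additive-ext Φ-add Ψ-add agree p)) (sym (Ψ∷ s p)))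

*-additive : (c : ℚ) {Φ : Poly n → ℚ} → Additive Φ → Additive (λ p → c *ℚ Φ p)
*-additive c (mkAdditive Φ[] Φ∷) = mkAdditive
  (trans (cong (c *ℚ_) Φ[]) (ℚ.*-zeroʳ c))
  (λ s p → trans (cong (c *ℚ_) (Φ∷ s p)) (ℚ.*-distribˡ-+ c _ _))

+-additive : {Φ Ψ : Poly n → ℚ} → Additive Φ → Additive Ψ → Additive (λ p → Φ p +ℚ Ψ p)
+-additive {Φ = Φ} {Ψ} (mkAdditive Φ[] Φ∷) (mkAdditive Ψ[] Ψ∷) = mkAdditive
  (cong₂ _+ℚ_ Φ[] Ψ[])
  (λ s p → trans (cong₂ _+ℚ_ (Φ∷ s p) (Ψ∷ s p)) (+ℚ-interchange (Φ [ s ]) (Φ p) (Ψ [ s ]) (Ψ p)))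

scale-additive : (c : ℚ) {Φ : Poly n → ℚ} → Additive Φ → Additive (λ p → Φ (scale c p))
scale-additive c (mkAdditive Φ[] Φ∷) = mkAdditive Φ[] (λ (d , a) p → Φ∷ (c *ℚ d , a) (scale c p))

coeff-additive : (m : Mono n) → Additive (λ p → coeff p m)
coeff-additive m = mkAdditive refl (λ s p → coeff-⊕ [ s ] p m)

⊗-additiveˡ : (q : Poly n) (m : Mono n) → Additive (λ p → coeff (p ⊗ q) m)
⊗-additiveˡ q m = mkAdditive refl (λ s p → coeff-⊕-⊗ [ s ] p q m)

⊗-additiveʳ : (s : ℚ × Mono n) (m : Mono n) → Additive (λ q → coeff ([ s ] ⊗ q) m)
⊗-additiveʳ (c , a) m = mkAdditive refl (λ (d , b) q → coeff-⊕ [ (c *ℚ d , monoMul a b) ] ([ (c , a) ] ⊗ q) m)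

coeff-[*] : (c d : ℚ) (a m : Mono n) → coeff [ (c *ℚ d , a) ] m ≡ c *ℚ coeff [ (d , a) ] m
coeff-[*] c d a = coeff-scale c [ (d , a) ]

-- No ≈ᵐ step is needed, unlike in coeff-⊗-const: monoMul monoOne b reduces to b.
coeff-const-⊗ : (c : ℚ) (q : Poly n) (m : Mono n) → coeff (const c ⊗ q) m ≡ c *ℚ coeff q m
coeff-const-⊗ c q m =
  additive-ext (⊗-additiveʳ (c , monoOne) m) (*-additive c (coeff-additive m)) (λ (d , b) → coeff-[*] c d b m) q

coeff-⊗-const : (c : ℚ) (p : Poly n) (m : Mono n) → coeff (p ⊗ const c) m ≡ c *ℚ coeff p m
coeff-⊗-const c p m = additive-ext (⊗-additiveˡ (const c) m) (*-additive c (coeff-additive m)) single p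
  where
  single : ∀ s → coeff ([ s ] ⊗ const c) m ≡ c *ℚ coeff [ s ] m
  single (d , a) = begin
    coeff [ (d *ℚ c , monoMul a monoOne) ] m ≡⟨ coeff-≈ᵐ (λ i j b → +-identityʳ (a i j b)) (d *ℚ c) [] m ⟩
    coeff [ (d *ℚ c , a) ] m                 ≡⟨ cong (λ e → coeff [ (e , a) ] m) (ℚ.*-comm d c) ⟩
    coeff [ (c *ℚ d , a) ] m                 ≡⟨ coeff-[*] c d a m ⟩
    c *ℚ coeff [ (d , a) ] m                 ∎
    where open ≡-Reasoning

coeff-scale-⊗ : (c : ℚ) (p q : Poly n) (m : Mono n) → coeff (scale c p ⊗ q) m ≡ c *ℚ coeff (p ⊗ q) m
coeff-scale-⊗ c p q m =
  additive-ext (scale-additive c (⊗-additiveˡ q m)) (*-additive c (⊗-additiveˡ q m)) single p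
  where
  single : ∀ s → coeff (scale c [ s ] ⊗ q) m ≡ c *ℚ coeff ([ s ] ⊗ q) m
  single (d , a) =
    additive-ext (⊗-additiveʳ (c *ℚ d , a) m) (*-additive c (⊗-additiveʳ (d , a) m))
      (λ (d' , b) → trans (cong (λ e → coeff [ (e , monoMul a b) ] m) (ℚ.*-assoc c d d'))
                          (coeff-[*] c (d *ℚ d') (monoMul a b) m))
      q

coeff-⊗-scale : (c : ℚ) (p q : Poly n) (m : Mono n) → coeff (p ⊗ scale c q) m ≡ c *ℚ coeff (p ⊗ q) m
coeff-⊗-scale c p q m =
  additive-ext (⊗-additiveˡ (scale c q) m) (*-additive c (⊗-additiveˡ q m)) single p
  where
  single : ∀ s → coeff ([ s ] ⊗ scale c q) m ≡ c *ℚ coeff ([ s ] ⊗ q) m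
  single s@(d , a) =
    additive-ext (scale-additive c (⊗-additiveʳ s m)) (*-additive c (⊗-additiveʳ s m))
      (λ (d' , b) → trans (cong (λ e → coeff [ (e , monoMul a b) ] m) (*ℚ-x∙yz≈y∙xz d c d'))
                          (coeff-[*] c (d *ℚ d') (monoMul a b) m))
      q

coeff-⊗-⊕ : (p q q' : Poly n) (m : Mono n) → coeff (p ⊗ (q ⊕ q')) m ≡ coeff (p ⊗ q) m +ℚ coeff (p ⊗ q') m
coeff-⊗-⊕ p q q' m =
  additive-ext (⊗-additiveˡ (q ⊕ q') m) (+-additive (⊗-additiveˡ q m) (⊗-additiveˡ q' m)) (λ s → single s q) p
  where
  single : ∀ s q → coeff ([ s ] ⊗ (q ⊕ q')) m ≡ coeff ([ s ] ⊗ q) m +ℚ coeff ([ s ] ⊗ q') m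
  single s []       = sym (ℚ.+-identityˡ _)
  single s (s' ∷ q) = begin
    coeff ([ s ] ⊗ (s' ∷ q ⊕ q')) m      ≡⟨ split s' (q ⊕ q') ⟩
    head +ℚ coeff ([ s ] ⊗ (q ⊕ q')) m   ≡⟨ cong (head +ℚ_) (single s q) ⟩
    head +ℚ (tail +ℚ right)              ≡⟨ sym (ℚ.+-assoc head tail right) ⟩
    (head +ℚ tail) +ℚ right              ≡⟨ cong (_+ℚ right) (sym (split s' q)) ⟩
    coeff ([ s ] ⊗ (s' ∷ q)) m +ℚ right  ∎
    where
    open ≡-Reasoning
    head = coeff ([ s ] ⊗ [ s' ]) m
    tail = coeff ([ s ] ⊗ q) m
    right = coeff ([ s ] ⊗ q') m
    split = Additive.on-∷ (⊗-additiveʳ s m)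

coeff-affine-⊗ : (p q : Poly n) (β δ : ℚ) (m : Mono n) →
  coeff ((p ⊕ const β) ⊗ (q ⊕ const δ)) m ≡
  (coeff (p ⊗ q) m +ℚ δ *ℚ coeff p m) +ℚ (β *ℚ coeff q m +ℚ β *ℚ (δ *ℚ coeff (const 1ℚ) m))
coeff-affine-⊗ p q β δ m = begin
  coeff ((p ⊕ const β) ⊗ (q ⊕ const δ)) m
    ≡⟨ coeff-⊕-⊗ p (const β) (q ⊕ const δ) m ⟩
  coeff (p ⊗ (q ⊕ const δ)) m +ℚ coeff (const β ⊗ (q ⊕ const δ)) m
    ≡⟨ cong₂ _+ℚ_ (coeff-⊗-⊕ p q (const δ) m) (coeff-⊗-⊕ (const β) q (const δ) m) ⟩
  (coeff (p ⊗ q) m +ℚ coeff (p ⊗ const δ) m) +ℚ (coeff (const β ⊗ q) m +ℚ coeff (const β ⊗ const δ) m)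
    ≡⟨ cong₂ _+ℚ_ (cong (coeff (p ⊗ q) m +ℚ_) (coeff-⊗-const δ p m))
                  (cong₂ _+ℚ_ (coeff-const-⊗ β q m)
                              (trans (coeff-const-⊗ β (const δ) m) (cong (β *ℚ_) (coeff-const δ m)))) ⟩
  (coeff (p ⊗ q) m +ℚ δ *ℚ coeff p m) +ℚ (β *ℚ coeff q m +ℚ β *ℚ (δ *ℚ coeff (const 1ℚ) m))
    ∎
  where open ≡-Reasoning

sumF≡sumL-tabulate : (f : Fin k → Poly n) → sumF f ≡ sumL (tabulate f)
sumF≡sumL-tabulate f = cong sumL (map-tabulate (λ i → i) f)

coeff-sumL-tabulate : (f : Fin k → Poly n) (m : Mono n) → coeff (sumL (tabulate f)) m ≡ ∑[ i < k ] coeff (f i) m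
coeff-sumL-tabulate {zero}  f m = refl
coeff-sumL-tabulate {suc k} f m =
  trans (coeff-⊕ (f zero) _ m) (cong (coeff (f zero) m +ℚ_) (coeff-sumL-tabulate (λ i → f (suc i)) m))

coeff-sumF : (f : Fin k → Poly n) (m : Mono n) → coeff (sumF f) m ≡ ∑[ i < k ] coeff (f i) m
coeff-sumF f m = trans (cong (λ p → coeff p m) (sumF≡sumL-tabulate f)) (coeff-sumL-tabulate f m)

coeff-sumF-zero : (f : Fin k → Poly n) (m : Mono n) → (∀ i → coeff (f i) m ≡ 0ℚ) → coeff (sumF f) m ≡ 0ℚ
coeff-sumF-zero {k} f m f≗0 = trans (coeff-sumF f m) (trans (sum-cong-≗ f≗0) (sum-replicate-zero k))

×ℚ-as-* : (k : ℕ) (q : ℚ) → k ×ℚ q ≡ (k ×ℚ 1ℚ) *ℚ q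
×ℚ-as-* k q = trans (cong (k ×ℚ_) (sym (ℚ.*-identityˡ q))) (sym (×-assoc-* k 1ℚ q))

∑-telescope : (g : Fin (suc k) → ℚ) → ∑[ i < k ] (g (suc i) -ℚ g (inject₁ i)) ≡ g (fromℕ k) -ℚ g zero
∑-telescope {zero}  g = sym (ℚ.+-inverseʳ (g zero))
∑-telescope {suc k} g = begin
  (g₁ -ℚ g₀) +ℚ ∑[ i < k ] (g (suc (suc i)) -ℚ g (suc (inject₁ i)))
    ≡⟨ cong ((g₁ -ℚ g₀) +ℚ_) (∑-telescope (λ i → g (suc i))) ⟩
  (g₁ -ℚ g₀) +ℚ (gₗ -ℚ g₁)
    ≡⟨ solve 3 (λ a b c → (a :- b) :+ (c :- a) := c :- b) refl g₁ g₀ gₗ ⟩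
  gₗ -ℚ g₀
    ∎
  where
  open ≡-Reasoning
  open +-*-Solver
  g₀ = g zero
  g₁ = g (suc zero)
  gₗ = g (fromℕ (suc k))

indexedSum : {A : Set} → (ℕ → A → ℚ) → List A → ℚ
indexedSum g []       = 0ℚ
indexedSum g (a ∷ as) = g 0 a +ℚ indexedSum (λ j → g (suc j)) as

∑-lookup : {A : Set} (g : ℕ → A → ℚ) (as : List A) →
           ∑[ i < length as ] g (toℕ i) (lookup as i) ≡ indexedSum g as
∑-lookup g []       = refl
∑-lookup g (a ∷ as) = cong (g 0 a +ℚ_) (∑-lookup (λ j → g (suc j)) as)

indexedSum-tabulate-++ : {A : Set} (g : ℕ → A → ℚ) (f : Fin k → A) (as : List A) →
  indexedSum g (tabulate f ++ as) ≡ ∑[ i < k ] g (toℕ i) (f i) +ℚ indexedSum (λ j → g (k + j)) as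
indexedSum-tabulate-++ {zero}  g f as = sym (ℚ.+-identityˡ _)
indexedSum-tabulate-++ {suc k} g f as =
  trans (cong (g 0 (f zero) +ℚ_) (indexedSum-tabulate-++ (λ j → g (suc j)) (λ i → f (suc i)) as))
        (sym (ℚ.+-assoc (g 0 (f zero)) _ _))

-- Unlike DegLe, this bounds every listed term, also those whose coefficients cancel;
-- in exchange it is preserved by ⊗ term by term.
TermsDegLe : Poly n → ℕ → Set
TermsDegLe p d = All (λ (_ , a) → monoDeg a ≤ d) p

TermsDegLe⇒DegLe : {p : Poly n} {d : ℕ} → TermsDegLe p d → DegLe p d
TermsDegLe⇒DegLe {p = []}          []       m c≢0 = ⊥-elim (c≢0 refl)
TermsDegLe⇒DegLe {p = (c , a) ∷ p} (a≤d ∷ p≤d) m c≢0 with a ≈ᵐ? m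
... | yes a≈m = ≤-trans (≤-reflexive (sym (monoDeg-cong a≈m))) a≤d
... | no  _   = TermsDegLe⇒DegLe p≤d m c≢0

TermsDegLe-weaken : {p : Poly n} {d d' : ℕ} → d ≤ d' → TermsDegLe p d → TermsDegLe p d'
TermsDegLe-weaken d≤d' = All.map (λ a≤d → ≤-trans a≤d d≤d')

TermsDegLe-const : (c : ℚ) → TermsDegLe (const {n} c) 0
TermsDegLe-const {n} c = ≤-reflexive (monoDeg-monoOne {n}) ∷ []

TermsDegLe-x : (i : Fin n) (j : Fin (2 * n)) → TermsDegLe (x i j) 1
TermsDegLe-x i j = ≤-reflexive (monoDeg-monoVar i j false) ∷ []

TermsDegLe-neg : {p : Poly n} {d : ℕ} → TermsDegLe p d → TermsDegLe (neg p) d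
TermsDegLe-neg = map⁺

TermsDegLe-scale : (c : ℚ) {p : Poly n} {d : ℕ} → TermsDegLe p d → TermsDegLe (scale c p) d
TermsDegLe-scale c = map⁺

TermsDegLe-⊗ : {p q : Poly n} {d e : ℕ} → TermsDegLe p d → TermsDegLe q e → TermsDegLe (p ⊗ q) (d + e)
TermsDegLe-⊗ {p = []}          []          q≤e = []
TermsDegLe-⊗ {p = (c , a) ∷ p} (a≤d ∷ p≤d) q≤e =
  ++⁺ (map⁺ (All.map (λ {(_ , b)} b≤e → ≤-trans (≤-reflexive (monoDeg-monoMul a b)) (+-mono-≤ a≤d b≤e))
                     q≤e))
      (TermsDegLe-⊗ p≤d q≤e)

TermsDegLe-sumL : {ps : List (Poly n)} {d : ℕ} → All (λ p → TermsDegLe p d) ps → TermsDegLe (sumL ps) d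
TermsDegLe-sumL []           = []
TermsDegLe-sumL (p≤d ∷ ps≤d) = ++⁺ p≤d (TermsDegLe-sumL ps≤d)

TermsDegLe-sumF : {f : Fin k → Poly n} {d : ℕ} → (∀ i → TermsDegLe (f i) d) → TermsDegLe (sumF f) d
TermsDegLe-sumF f≤d = TermsDegLe-sumL (map⁺ (tabulate⁺ f≤d))

TermsDegLe-ks : (i : Fin n) → TermsDegLe (ks i) 1
TermsDegLe-ks i =
  ++⁺ (TermsDegLe-sumF (TermsDegLe-x i)) (TermsDegLe-neg (TermsDegLe-weaken z≤n (TermsDegLe-const _)))

TermsDegLe-affine-ks : (c d : ℚ) (j : Fin n) → TermsDegLe (scale c (ks j) ⊕ const d) 1
TermsDegLe-affine-ks c d j = ++⁺ (TermsDegLe-scale c (TermsDegLe-ks j)) (TermsDegLe-weaken z≤n (TermsDegLe-const d))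

finSum-≤ : {f : Fin k → ℕ} {b : ℕ} → (∀ i → f i ≤ b) → finSum f ≤ k * b
finSum-≤ {zero}  f≤b = z≤n
finSum-≤ {suc k} f≤b = +-mono-≤ (f≤b zero) (finSum-≤ (λ i → f≤b (suc i)))

sumℕ-tabulate-≤ : {A : Set} {f : Fin k → A} (h : A → ℕ) {b : ℕ} →
                  (∀ i → h (f i) ≤ b) → sumℕ (map h (tabulate f)) ≤ k * b
sumℕ-tabulate-≤ {zero}  h hf≤b = z≤n
sumℕ-tabulate-≤ {suc k} h hf≤b = +-mono-≤ (hf≤b zero) (sumℕ-tabulate-≤ h (λ i → hf≤b (suc i)))

nMonos≤length : (p : Poly n) → nMonos p ≤ length p
nMonos≤length p =
  ≤-trans (length-deduplicate _≈ᵐ?_ (filter nonzero (map proj₂ p)))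
          (≤-trans (length-filter nonzero (map proj₂ p)) (≤-reflexive (length-map proj₂ p)))
  where nonzero = λ m → ¬? (coeff p m ℚ.≟ 0ℚ)

length-⊗ : (p q : Poly n) → length (p ⊗ q) ≡ length p * length q
length-⊗ []      q = refl
length-⊗ (_ ∷ p) q = trans (length-++ (map _ q)) (cong₂ _+_ (length-map _ q) (length-⊗ p q))

length-sumL-tabulate : {f : Fin k → Poly n} {ℓ : ℕ} →
                       (∀ i → length (f i) ≡ ℓ) → length (sumL (tabulate f)) ≡ k * ℓ
length-sumL-tabulate {zero}          f≡ℓ = refl
length-sumL-tabulate {suc k} {f = f} f≡ℓ =
  trans (length-++ (f zero)) (cong₂ _+_ (f≡ℓ zero) (length-sumL-tabulate (λ i → f≡ℓ (suc i))))

length-ks : (i : Fin n) → length (ks i) ≡ 2 * n + 1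
length-ks {n} i = begin
  length (ks i)                      ≡⟨ length-++ (sumF (x i)) ⟩
  length (sumF (x i)) + 1            ≡⟨ cong (λ p → length p + 1) (sumF≡sumL-tabulate (x i)) ⟩
  length (sumL (tabulate (x i))) + 1 ≡⟨ cong (_+ 1) (length-sumL-tabulate {2 * n} {f = x i} (λ _ → refl)) ⟩
  2 * n * 1 + 1                      ≡⟨ cong (_+ 1) (*-identityʳ (2 * n)) ⟩
  2 * n + 1                          ∎
  where open ≡-Reasoning

length-affine-ks : (c d : ℚ) (j : Fin n) → length (scale c (ks j) ⊕ const d) ≡ 2 * n + 1 + 1
length-affine-ks c d j = trans (length-++ (scale c (ks j))) (cong (_+ 1) (trans (length-map _ (ks j)) (length-ks j)))

-- The left-hand side equals 4k³ + 36k² + 73k + 44.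
cubic-bound : (k : ℕ) →
  let ℓ = 2 * suc k + 1 in
  k * (ℓ + 1) + suc (k + 1) * ((ℓ + 1) + (ℓ * ℓ + ℓ + 1)) + suc k * (2 * suc k * 5) ≤ 50 * suc k ^ 3
cubic-bound k = ≤-trans (m≤m+n _ (46 * k * k * k + 114 * k * k + 77 * k + 6)) (≤-reflexive (expand k))
  where
  expand : ∀ k → let ℓ = 2 * suc k + 1 in
    k * (ℓ + 1) + suc (k + 1) * ((ℓ + 1) + (ℓ * ℓ + ℓ + 1)) + suc k * (2 * suc k * 5)
      + (46 * k * k * k + 114 * k * k + 77 * k + 6) ≡ 50 * (suc k * (suc k * (suc k * 1)))
  expand = solve-∀

-- Here n = suc k and indices are 0-based: weight i is w_{i+1}, and multiplier j multiplies
-- the j-th entry of Q (suc k).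
module Refutation (k : ℕ) where

  weight : ℕ → ℚ
  weight zero    = (4 + k) ×ℚ 1ℚ
  weight (suc i) = weight i *ℚ weight i

  root : Fin k → Poly (suc k)
  root i = scale (weight (toℕ i)) (ks (suc i)) ⊕ const (-ℚ ½)

  multiplier : ℕ → Poly (suc k)
  multiplier zero    = scale (weight 0) (ks zero) ⊕ const (weight 0 *ℚ ½)
  multiplier (suc i) = const (-ℚ weight i)

  middle : Fin k → Poly (suc k)
  middle i = (ks (inject₁ i) ⊗ ks (inject₁ i)) ⊖ ks (suc i)

  -- With u = v = [] the Boolean and twin axioms contribute nothing.
  squares constraints axioms : Poly (suc k)
  squares     = sumL (map (λ p → p ⊗ p) (tabulate root))
  constraints = sumF (λ κ → multiplier (toℕ κ) ⊗ lookup (Q (suc k)) κ)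
  axioms      = sumF (λ (_ : Fin (suc k)) → sumF (λ (_ : Fin (2 * suc k)) → []))

  module Coefficients (m : Mono (suc k)) where
    open +-*-Solver
    open ≡-Reasoning

    y z : Fin (suc k) → ℚ
    y j = coeff (ks j) m
    z j = coeff (ks j ⊗ ks j) m

    e ¼e : ℚ
    e  = coeff (const 1ℚ) m
    ¼e = (½ *ℚ ½) *ℚ e

    square-coeff middle-coeff : Fin k → ℚ
    square-coeff i = (weight (suc (toℕ i)) *ℚ z (suc i) -ℚ weight (toℕ i) *ℚ y (suc i)) +ℚ ¼e
    middle-coeff i = -ℚ weight (toℕ i) *ℚ (z (inject₁ i) -ℚ y (suc i))

    first-coeff last-coeff : ℚ
    first-coeff = weight 0 *ℚ z zero -ℚ weight 0 *ℚ ¼e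
    last-coeff  = -ℚ weight k *ℚ z (fromℕ k)

    coeff-root² : (i : Fin k) → coeff (root i ⊗ root i) m ≡ square-coeff i
    coeff-root² i = begin
      coeff (root i ⊗ root i) m
        ≡⟨ coeff-affine-⊗ (scale w Z) (scale w Z) (-ℚ ½) (-ℚ ½) m ⟩
      (coeff (scale w Z ⊗ scale w Z) m +ℚ (-ℚ ½) *ℚ coeff (scale w Z) m)
        +ℚ ((-ℚ ½) *ℚ coeff (scale w Z) m +ℚ (-ℚ ½) *ℚ ((-ℚ ½) *ℚ e))
        ≡⟨ cong₂ (λ a b → (a +ℚ (-ℚ ½) *ℚ b) +ℚ ((-ℚ ½) *ℚ b +ℚ (-ℚ ½) *ℚ ((-ℚ ½) *ℚ e)))
                 (trans (coeff-scale-⊗ w Z (scale w Z) m) (cong (w *ℚ_) (coeff-⊗-scale w Z Z m)))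
                 (coeff-scale w Z m) ⟩
      (w *ℚ (w *ℚ z (suc i)) +ℚ (-ℚ ½) *ℚ (w *ℚ y (suc i)))
        +ℚ ((-ℚ ½) *ℚ (w *ℚ y (suc i)) +ℚ (-ℚ ½) *ℚ ((-ℚ ½) *ℚ e))
        ≡⟨ solve 4 (λ w z y e →
                      (w :* (w :* z) :+ (:- con ½) :* (w :* y))
                        :+ ((:- con ½) :* (w :* y) :+ (:- con ½) :* ((:- con ½) :* e))
                      := (w :* w :* z :- w :* y) :+ (con ½ :* con ½) :* e)
                 refl w (z (suc i)) (y (suc i)) e ⟩
      square-coeff i
        ∎
      where
      w = weight (toℕ i)
      Z = ks (suc i)

    coeff-first : coeff (multiplier 0 ⊗ (ks zero ⊖ const ½)) m ≡ first-coeff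
    coeff-first = begin
      coeff (multiplier 0 ⊗ (ks zero ⊖ const ½)) m
        ≡⟨ coeff-affine-⊗ (scale w Z) Z (w *ℚ ½) (-ℚ ½) m ⟩
      (coeff (scale w Z ⊗ Z) m +ℚ (-ℚ ½) *ℚ coeff (scale w Z) m) +ℚ rest
        ≡⟨ cong₂ (λ a b → (a +ℚ (-ℚ ½) *ℚ b) +ℚ rest) (coeff-scale-⊗ w Z Z m) (coeff-scale w Z m) ⟩
      (w *ℚ z zero +ℚ (-ℚ ½) *ℚ (w *ℚ y zero)) +ℚ rest
        ≡⟨ solve 4 (λ w z y e →
                      (w :* z :+ (:- con ½) :* (w :* y))
                        :+ ((w :* con ½) :* y :+ (w :* con ½) :* ((:- con ½) :* e))
                      := w :* z :- w :* ((con ½ :* con ½) :* e))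
                 refl w (z zero) (y zero) e ⟩
      first-coeff
        ∎
      where
      w = weight 0
      Z = ks zero
      rest = (w *ℚ ½) *ℚ y zero +ℚ (w *ℚ ½) *ℚ ((-ℚ ½) *ℚ e)

    coeff-middle : (i : Fin k) → coeff (multiplier (suc (toℕ i)) ⊗ middle i) m ≡ middle-coeff i
    coeff-middle i =
      trans (coeff-const-⊗ (-ℚ weight (toℕ i)) (middle i) m)
            (cong (-ℚ weight (toℕ i) *ℚ_)
                  (trans (coeff-⊕ (ks (inject₁ i) ⊗ ks (inject₁ i)) (neg (ks (suc i))) m)
                         (cong (z (inject₁ i) +ℚ_) (coeff-neg (ks (suc i)) m))))

    coeff-last : coeff (multiplier (suc (k + 0)) ⊗ (ks (fromℕ k) ⊗ ks (fromℕ k))) m ≡ last-coeff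
    coeff-last =
      trans (coeff-const-⊗ (-ℚ weight (k + 0)) (ks (fromℕ k) ⊗ ks (fromℕ k)) m)
            (cong (λ j → -ℚ weight j *ℚ z (fromℕ k)) (+-identityʳ k))

    coeff-squares : coeff squares m ≡ ∑[ i < k ] square-coeff i
    coeff-squares = begin
      coeff squares m                                 ≡⟨ cong (λ ps → coeff (sumL ps) m) (map-tabulate root _) ⟩
      coeff (sumL (tabulate λ i → root i ⊗ root i)) m ≡⟨ coeff-sumL-tabulate (λ i → root i ⊗ root i) m ⟩
      ∑[ i < k ] coeff (root i ⊗ root i) m            ≡⟨ sum-cong-≗ coeff-root² ⟩
      ∑[ i < k ] square-coeff i                       ∎

    coeff-constraints : coeff constraints m ≡ first-coeff +ℚ (∑[ i < k ] middle-coeff i +ℚ last-coeff)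
    coeff-constraints = begin
      coeff constraints m
        ≡⟨ coeff-sumF (λ κ → multiplier (toℕ κ) ⊗ lookup (Q (suc k)) κ) m ⟩
      ∑[ κ < length (Q (suc k)) ] G (toℕ κ) (lookup (Q (suc k)) κ)
        ≡⟨ ∑-lookup G (Q (suc k)) ⟩
      G 0 Q₀ +ℚ indexedSum (λ j → G (suc j)) (map middle (allFin k) ++ [ Qₗ ])
        ≡⟨ cong (λ qs → G 0 Q₀ +ℚ indexedSum (λ j → G (suc j)) (qs ++ [ Qₗ ]))
                (map-tabulate (λ i → i) middle) ⟩
      G 0 Q₀ +ℚ indexedSum (λ j → G (suc j)) (tabulate middle ++ [ Qₗ ])
        ≡⟨ cong (G 0 Q₀ +ℚ_) (indexedSum-tabulate-++ (λ j → G (suc j)) middle [ Qₗ ]) ⟩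
      G 0 Q₀ +ℚ (∑[ i < k ] G (suc (toℕ i)) (middle i) +ℚ (G (suc (k + 0)) Qₗ +ℚ 0ℚ))
        ≡⟨ cong₂ _+ℚ_ coeff-first
                 (cong₂ _+ℚ_ (sum-cong-≗ coeff-middle) (trans (ℚ.+-identityʳ _) coeff-last)) ⟩
      first-coeff +ℚ (∑[ i < k ] middle-coeff i +ℚ last-coeff)
        ∎
      where
      G : ℕ → Poly (suc k) → ℚ
      G j q = coeff (multiplier j ⊗ q) m
      Q₀ = ks zero ⊖ const ½
      Qₗ = ks (fromℕ k) ⊗ ks (fromℕ k)

    coeff-axioms : coeff axioms m ≡ 0ℚ
    coeff-axioms =
      coeff-sumF-zero {k = suc k} (λ _ → sumF {k = 2 * suc k} (λ _ → [])) m λ _ →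
      coeff-sumF-zero {k = 2 * suc k} (λ _ → []) m λ _ → refl

    telescoped :
      ∑[ i < k ] square-coeff i +ℚ ∑[ i < k ] middle-coeff i
      ≡ (weight k *ℚ z (fromℕ k) -ℚ weight 0 *ℚ z zero) +ℚ k ×ℚ ¼e
    telescoped = begin
      ∑[ i < k ] square-coeff i +ℚ ∑[ i < k ] middle-coeff i
        ≡⟨ sym (∑-distrib-+ square-coeff middle-coeff) ⟩
      ∑[ i < k ] (square-coeff i +ℚ middle-coeff i)
        ≡⟨ sum-cong-≗ pairwise ⟩
      ∑[ i < k ] ((g (suc i) -ℚ g (inject₁ i)) +ℚ ¼e)
        ≡⟨ ∑-distrib-+ (λ i → g (suc i) -ℚ g (inject₁ i)) (λ _ → ¼e) ⟩
      ∑[ i < k ] (g (suc i) -ℚ g (inject₁ i)) +ℚ ∑[ i < k ] ¼e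
        ≡⟨ cong₂ _+ℚ_ (∑-telescope g) (sum-replicate k) ⟩
      (g (fromℕ k) -ℚ g zero) +ℚ k ×ℚ ¼e
        ≡⟨ cong (λ j → (weight j *ℚ z (fromℕ k) -ℚ g zero) +ℚ k ×ℚ ¼e) (toℕ-fromℕ k) ⟩
      (weight k *ℚ z (fromℕ k) -ℚ weight 0 *ℚ z zero) +ℚ k ×ℚ ¼e
        ∎
      where
      g : Fin (suc k) → ℚ
      g j = weight (toℕ j) *ℚ z j
      pairwise : ∀ i → square-coeff i +ℚ middle-coeff i ≡ (g (suc i) -ℚ g (inject₁ i)) +ℚ ¼e
      pairwise i = trans
        (solve 5 (λ w z′ y′ z ¼e → ((w :* w :* z′ :- w :* y′) :+ ¼e) :+ (:- w) :* (z :- y′)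
                                   := (w :* w :* z′ :- w :* z) :+ ¼e)
               refl (weight (toℕ i)) (z (suc i)) (y (suc i)) (z (inject₁ i)) ¼e)
        (cong (λ j → (g (suc i) -ℚ weight j *ℚ z (inject₁ i)) +ℚ ¼e) (sym (toℕ-inject₁ i)))

    refutes : coeff (squares ⊕ (constraints ⊕ axioms)) m ≡ coeff (const (-ℚ 1ℚ)) m
    refutes = begin
      coeff (squares ⊕ (constraints ⊕ axioms)) m
        ≡⟨ coeff-⊕ squares (constraints ⊕ axioms) m ⟩
      coeff squares m +ℚ coeff (constraints ⊕ axioms) m
        ≡⟨ cong (coeff squares m +ℚ_) (coeff-⊕ constraints axioms m) ⟩
      coeff squares m +ℚ (coeff constraints m +ℚ coeff axioms m)
        ≡⟨ cong₂ _+ℚ_ coeff-squares (cong₂ _+ℚ_ coeff-constraints coeff-axioms) ⟩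
      ∑squares +ℚ ((first-coeff +ℚ (∑middles +ℚ last-coeff)) +ℚ 0ℚ)
        ≡⟨ solve 4 (λ s f s′ l → s :+ ((f :+ (s′ :+ l)) :+ con 0ℚ) := (s :+ s′) :+ (f :+ l))
                 refl ∑squares first-coeff ∑middles last-coeff ⟩
      (∑squares +ℚ ∑middles) +ℚ ends
        ≡⟨ cong (_+ℚ ends) telescoped ⟩
      ((wₖ *ℚ zₖ -ℚ w₀ *ℚ z₀) +ℚ k ×ℚ ¼e) +ℚ ends
        ≡⟨ cong (λ c → ((wₖ *ℚ zₖ -ℚ w₀ *ℚ z₀) +ℚ c) +ℚ ends) (×ℚ-as-* k ¼e) ⟩
      ((wₖ *ℚ zₖ -ℚ w₀ *ℚ z₀) +ℚ (k ×ℚ 1ℚ) *ℚ ¼e) +ℚ ends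
        ≡⟨ solve 5 (λ κ e wₖ zₖ z₀ →
                      let w₀ = con 1ℚ :+ (con 1ℚ :+ (con 1ℚ :+ (con 1ℚ :+ κ)))
                          ¼e = (con ½ :* con ½) :* e
                      in ((wₖ :* zₖ :- w₀ :* z₀) :+ κ :* ¼e)
                           :+ ((w₀ :* z₀ :- w₀ :* ¼e) :+ (:- wₖ) :* zₖ)
                         := (:- con 1ℚ) :* e)
                 refl (k ×ℚ 1ℚ) e wₖ zₖ z₀ ⟩
      -ℚ 1ℚ *ℚ e
        ≡⟨ sym (coeff-const (-ℚ 1ℚ) m) ⟩
      coeff (const (-ℚ 1ℚ)) m
        ∎
      where
      w₀ = weight 0
      wₖ = weight k
      z₀ = z zero
      zₖ = z (fromℕ k)
      ∑squares = ∑[ i < k ] square-coeff i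
      ∑middles = ∑[ i < k ] middle-coeff i
      ends = first-coeff +ℚ last-coeff

  refutation : SOSRefutation (suc k)
  refutation = record
    { r        = tabulate root
    ; t        = λ κ → multiplier (toℕ κ)
    ; u        = λ _ _ → []
    ; v        = λ _ _ → []
    ; identity = λ m → sym (Coefficients.refutes m)
    }

  root-degree : (i : Fin k) → TermsDegLe (root i) 1
  root-degree i = TermsDegLe-affine-ks (weight (toℕ i)) (-ℚ ½) (suc i)

  Q₀-degree : TermsDegLe (ks {suc k} zero ⊖ const ½) 1
  Q₀-degree = ++⁺ (TermsDegLe-ks zero) (TermsDegLe-neg (TermsDegLe-weaken z≤n (TermsDegLe-const ½)))

  Q-degree : All (λ q → TermsDegLe q 2) (Q (suc k))
  Q-degree =
    TermsDegLe-weaken (s≤s z≤n) Q₀-degree ∷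
    ++⁺ (map⁺ (tabulate⁺ middle-degree)) (square-degree (fromℕ k) ∷ [])
    where
    square-degree : (j : Fin (suc k)) → TermsDegLe (ks j ⊗ ks j) 2
    square-degree j = TermsDegLe-⊗ (TermsDegLe-ks j) (TermsDegLe-ks j)
    middle-degree : (i : Fin k) → TermsDegLe (middle i) 2
    middle-degree i =
      ++⁺ (square-degree (inject₁ i)) (TermsDegLe-neg (TermsDegLe-weaken (s≤s z≤n) (TermsDegLe-ks (suc i))))

  constraint-degree : (κ : Fin (length (Q (suc k)))) → TermsDegLe (multiplier (toℕ κ) ⊗ lookup (Q (suc k)) κ) 2
  constraint-degree zero    = TermsDegLe-⊗ (TermsDegLe-affine-ks (weight 0) (weight 0 *ℚ ½) zero) Q₀-degree
  constraint-degree (suc κ) =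
    TermsDegLe-⊗ (TermsDegLe-const (-ℚ weight (toℕ κ))) (All.lookup Q-degree (∈-lookup {xs = Q (suc k)} (suc κ)))

  degree≤2 : HasDegreeAtMost refutation 2
  degree≤2 =
    (λ p p∈roots → let p≤1 = All.lookup (tabulate⁺ {P = λ p → TermsDegLe p 1} {f = root} root-degree) p∈roots
                   in TermsDegLe⇒DegLe (TermsDegLe-⊗ p≤1 p≤1)) ,
    (λ κ → TermsDegLe⇒DegLe (constraint-degree κ)) ,
    (λ _ _ → TermsDegLe⇒DegLe []) ,
    (λ _ _ → TermsDegLe⇒DegLe [])

  ℓ : ℕ
  ℓ = 2 * suc k + 1

  length-multiplier : (j : ℕ) → length (multiplier j) ≤ ℓ + 1
  length-multiplier zero    = ≤-reflexive (length-affine-ks (weight 0) (weight 0 *ℚ ½) zero)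
  length-multiplier (suc j) = s≤s z≤n

  Q-length : All (λ q → length q ≤ ℓ * ℓ + ℓ + 1) (Q (suc k))
  Q-length = Q₀-length ∷ ++⁺ (map⁺ (tabulate⁺ middle-length)) (square-length (fromℕ k) ∷ [])
    where
    length-square : (j : Fin (suc k)) → length (ks j ⊗ ks j) ≡ ℓ * ℓ
    length-square j = trans (length-⊗ (ks j) (ks j)) (cong₂ _*_ (length-ks j) (length-ks j))

    Q₀-length : length (ks {suc k} zero ⊖ const ½) ≤ ℓ * ℓ + ℓ + 1
    Q₀-length = ≤-trans (≤-reflexive (trans (length-++ (ks {suc k} zero)) (cong (_+ 1) (length-ks zero))))
                        (+-monoˡ-≤ 1 (m≤n+m ℓ (ℓ * ℓ)))

    middle-length : (i : Fin k) → length (middle i) ≤ ℓ * ℓ + ℓ + 1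
    middle-length i = ≤-trans (≤-reflexive (begin
      length (middle i)
        ≡⟨ length-++ (ks (inject₁ i) ⊗ ks (inject₁ i)) ⟩
      length (ks (inject₁ i) ⊗ ks (inject₁ i)) + length (neg (ks (suc i)))
        ≡⟨ cong₂ _+_ (length-square (inject₁ i)) (length-map _ (ks (suc i))) ⟩
      ℓ * ℓ + length (ks (suc i))
        ≡⟨ cong (ℓ * ℓ +_) (length-ks (suc i)) ⟩
      ℓ * ℓ + ℓ
        ∎))
      (m≤m+n (ℓ * ℓ + ℓ) 1)
      where open ≡-Reasoning

    square-length : (j : Fin (suc k)) → length (ks j ⊗ ks j) ≤ ℓ * ℓ + ℓ + 1
    square-length j =
      ≤-trans (≤-reflexive (length-square j)) (≤-trans (m≤m+n (ℓ * ℓ) ℓ) (m≤m+n (ℓ * ℓ + ℓ) 1))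

  length-Q : length (Q (suc k)) ≡ suc (k + 1)
  length-Q = cong suc (trans (length-++ (map middle (allFin k)))
                             (cong (_+ 1) (trans (length-map middle (allFin k)) (length-tabulate (λ i → i)))))

  monomialSize-bound : monomialSize refutation ≤ 50 * suc k ^ 3
  monomialSize-bound = ≤-trans (+-mono-≤ (+-mono-≤ squares-size constraints-size) axioms-size) (cubic-bound k)
    where
    R = refutation

    squares-size : sumℕ (map nMonos (r R)) ≤ k * (ℓ + 1)
    squares-size = sumℕ-tabulate-≤ nMonos λ i →
      ≤-trans (nMonos≤length (root i)) (≤-reflexive (length-affine-ks (weight (toℕ i)) (-ℚ ½) (suc i)))

    constraints-size : finSum (λ κ → nMonos (t R κ) + nMonos (lookup (Q (suc k)) κ))
                       ≤ suc (k + 1) * ((ℓ + 1) + (ℓ * ℓ + ℓ + 1))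
    constraints-size =
      ≤-trans (finSum-≤ λ κ → +-mono-≤ (≤-trans (nMonos≤length (t R κ)) (length-multiplier (toℕ κ)))
                                       (≤-trans (nMonos≤length (lookup (Q (suc k)) κ))
                                                (All.lookup Q-length (∈-lookup {xs = Q (suc k)} κ))))
              (≤-reflexive (cong (_* ((ℓ + 1) + (ℓ * ℓ + ℓ + 1))) length-Q))

    axioms-size : finSum (λ i → finSum (λ j →
                    nMonos (u R i j) + nMonos (v R i j) + nMonos (boolAx i j) + nMonos (twinAx i j)))
                  ≤ suc k * (2 * suc k * 5)
    axioms-size = finSum-≤ {suc k} λ i → finSum-≤ {2 * suc k} λ j →
      +-mono-≤ (nMonos≤length (boolAx i j)) (nMonos≤length (twinAx i j))

open Refutation using (refutation; degree≤2; monomialSize-bound)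

lemma3 : Σ ℕ λ c → Σ ℕ λ e → (n : ℕ) → 1 ≤ n →
    Σ (SOSRefutation n) λ R → HasDegreeAtMost R 2 × monomialSize R ≤ c * n ^ e
lemma3 = 50 , 3 , λ { zero () ; (suc k) _ → refutation k , degree≤2 k , monomialSize-bound k }
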